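{- Let $n\ge 0$, $0\le k\le n$, and let $U,V\subseteq\{1,\ldots,n\}$ with $|U|=|V|$. Then $b(n,k,U)=b(n,k,V)$.
   Context: $\mathcal{B}_n$ is the set of signed permutations of order $n$: bijections $\sigma$ of $\{ -n,\ldots,-1,0,1,\ldots,n\}$ with $\sigma(-i)=-\sigma(i)$ for all $i$ (so $\sigma(0)=0$), identified with the sequence $(0,\sigma_1,\ldots,\sigma_n)$ where $\sigma_i=\sigma(i)$. The number of descents $\mathrm{des}(\sigma)$ is the number of $i\in\{1,\ldots,n\}$ with $\sigma_{i-1}>\sigma_i$, where $\sigma_0=0$. For $U\subseteq\{1,\ldots,n\}$ and $0\le k\le n$, $\mathcal{B}_{n,k,U}$ is the set of $\sigma\in\mathcal{B}_n$ with $\mathrm{des}(\sigma)=k$ such that for every $1\le i\le n$: $\sigma_i<0$ if and only if $|\sigma_i|\in U$; and $b(n,k,U):=|\mathcal{B}_{n,k,U}|$. -}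

module Defs where

open import Data.Nat using (ℕ; zero; suc; _≡ᵇ_)
open import Data.Integer using (ℤ; +_; -[1+_]; ∣_∣) renaming (_<_ to _<ℤ_)
open import Data.Integer.Properties using () renaming (_<?_ to _<ℤ?_)
open import Data.Bool using (Bool; true; false; _∧_; not; if_then_else_)
open import Data.List using (List; []; _∷_; map; concatMap; _++_; upTo; length; filter)
open import Data.Fin using (Fin; fromℕ<)
open import Data.Fin.Subset using (Subset)
open import Data.Vec using (lookup)
open import Relation.Nullary.Decidable using (⌊_⌋)
open import Data.Nat using (_<?_; _≟_)
open import Relation.Nullary using (yes; no)
open import Relation.Nullary.Decidable using (_×-dec_)
import Data.Bool

-- A signed permutation σ ∈ B_n is identified with its sequence
-- (σ_1 , … , σ_n) of nonzero integers in [-n, n] whose absolute values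
-- are pairwise distinct (hence form a permutation of 1..n); σ_0 = 0 is implicit.

values : ℕ → List ℤ
values n = map (λ j → + suc j) (upTo n) ++ map (λ j → -[1+ j ]) (upTo n)

sequences : ℕ → List ℤ → List (List ℤ)
sequences zero    vs = [] ∷ []
sequences (suc m) vs = concatMap (λ v → map (v ∷_) (sequences m vs)) vs

allL : {A : Set} → (A → Bool) → List A → Bool
allL p []       = true
allL p (x ∷ xs) = p x ∧ allL p xs

distinctAbs : List ℤ → Bool
distinctAbs []       = true
distinctAbs (x ∷ xs) = allL (λ y → not (∣ x ∣ ≡ᵇ ∣ y ∣)) xs ∧ distinctAbs xs

signedPerms : ℕ → List (List ℤ)
signedPerms n = filter (λ s → distinctAbs s Data.Bool.≟ true) (sequences n (values n))

-- number of descents: #{ i ∈ 1..n : σ_{i-1} > σ_i }, with σ_0 = 0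
desFrom : ℤ → List ℤ → ℕ
desFrom prev []       = 0
desFrom prev (x ∷ xs) = (if ⌊ x <ℤ? prev ⌋ then 1 else 0) Data.Nat.+ desFrom x xs

des : List ℤ → ℕ
des s = desFrom (+ 0) s

isNeg : ℤ → Bool
isNeg (+ _)    = false
isNeg -[1+ _ ] = true

-- membership of |x| ∈ {1..n} in U ⊆ {1..n}; U is a Subset n where
-- position j : Fin n represents the element j+1
memAbs : ∀ {n} → Subset n → ℤ → Bool
memAbs {n} U x = go ∣ x ∣
  where
  go : ℕ → Bool
  go zero = false
  go (suc j) with j <? n
  ... | yes p = lookup U (fromℕ< p)
  ... | no _  = false

signsMatch : ∀ {n} → Subset n → List ℤ → Bool
signsMatch U s = allL (λ x → ⌊ isNeg x Data.Bool.≟ memAbs U x ⌋) s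

b : (n k : ℕ) → Subset n → ℕ
b n k U = length (filter (λ s → (des s ≟ k) ×-dec (signsMatch U s Data.Bool.≟ true)) (signedPerms n))

-- Let c ∈ U with c + 1 ∉ U and let V = U - {c} ∪ {c + 1}. Exchanging the absolute values c and
-- c + 1 in a signed permutation while keeping every sign maps B_{n,k,U} bijectively onto B_{n,k,V}:
-- the exchange could only reverse the order of two entries with absolute values c and c + 1 and
-- the same sign, but in B_{n,k,U} the value c is negative and c + 1 is positive, so descents are
-- preserved. Any two subsets of the same size are linked by such moves and their inverses, e.g.
-- through the initial segment {1, …, |U|}. The bijection is a permutation of the list of all
-- candidate sequences, so it preserves the lengths of the filtered lists counted by b.

module Submission where

open import Defs
open import Data.Bool using (Bool; true; false; _∧_; not; T; if_then_else_)
open import Data.Bool.Properties using (T-∧; T-≡)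
import Data.Bool.Properties as Bool
open import Data.Fin using (fromℕ<)
open import Data.Fin.Subset using (Subset; ∣_∣)
open import Data.Fin.Subset.Properties using (∣p∣≤n)
open import Data.Integer using (ℤ; +_; -[1+_]; +<+; -<+; -<-) renaming (_<_ to _<ℤ_; ∣_∣ to ∣_∣ᶻ)
open import Data.Integer.Properties using () renaming (_<?_ to _<ℤ?_; <-cmp to <ℤ-cmp; <-irrefl to <ℤ-irrefl; <-asym to <ℤ-asym)
open import Data.List using (List; []; _∷_; _++_; map; concatMap; upTo; length; filter)
open import Data.List.Properties
  using (length-map; map-∘; map-cong; map-++; map-upTo; concatMap-cong; concatMap-map; map-concatMap; filter-≐)
import Data.List.Relation.Binary.Permutation.Propositional as ↭
open ↭ using (_↭_; ↭-refl; ↭-prep; ↭-swap; ↭-trans; ↭-reflexive; module PermutationReasoning)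
open import Data.List.Relation.Binary.Permutation.Propositional.Properties
  using (↭-length; filter-↭; map⁺; ++⁺; ++⁺ˡ; shifts)
open import Data.Nat using (ℕ; zero; suc; _+_; _<_; _≤_; z<s; s<s; s≤s; _<?_)
import Data.Nat.Properties as ℕ
open import Data.Product using (_×_; _,_; ∃-syntax)
open import Data.Vec using ([]; _∷_; lookup)
open import Function using (_∘_; Injective; _⇔_; mk⇔; Equivalence)
open import Level using (Level)
open import Relation.Binary using (Rel; tri<; tri≈; tri>)
open import Relation.Binary.Construct.Closure.Equivalence using (EqClosure; gmap; gfold; symmetric)
open import Relation.Binary.Construct.Closure.ReflexiveTransitive using (ε; _◅_; _◅◅_)
open import Relation.Binary.Construct.Closure.Symmetric using (bwd)
open import Relation.Binary.PropositionalEquality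
  using (_≡_; _≢_; refl; sym; trans; cong; cong₂; subst; isEquivalence; module ≡-Reasoning)
open import Relation.Nullary using (¬_; contradiction; Dec; does; yes; no)
open import Relation.Nullary.Decidable using (⌊_⌋; toWitness; isYes≗does; does-⇔; _×-dec_)
open import Relation.Unary using (Pred; Decidable; _≐_)
open import Relation.Unary.Properties using (_∩?_)

private variable
  ℓ p q : Level
  A B C A′ : Set ℓ

concatMap-↭ : (f : A → List B) {xs ys : List A} → xs ↭ ys → concatMap f xs ↭ concatMap f ys
concatMap-↭ f ↭.refl         = ↭-refl
concatMap-↭ f (↭.prep x p)   = ++⁺ˡ (f x) (concatMap-↭ f p)
concatMap-↭ f (↭.swap x y p) = ↭-trans (shifts (f x) (f y)) (++⁺ˡ (f y) (++⁺ˡ (f x) (concatMap-↭ f p)))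
concatMap-↭ f (↭.trans p q)  = ↭-trans (concatMap-↭ f p) (concatMap-↭ f q)

concatMap-cong-↭ : {f g : A → List B} → (∀ x → f x ↭ g x) → (xs : List A) → concatMap f xs ↭ concatMap g xs
concatMap-cong-↭ f↭g []       = ↭-refl
concatMap-cong-↭ f↭g (x ∷ xs) = ++⁺ (f↭g x) (concatMap-cong-↭ f↭g xs)

map-map-commute : {f : A → B} {g : B → C} {h : A → A′} {k : A′ → C} →
                  (∀ x → g (f x) ≡ k (h x)) → ∀ xs → map g (map f xs) ≡ map k (map h xs)
map-map-commute gf≗kh xs = trans (sym (map-∘ xs)) (trans (map-cong gf≗kh xs) (map-∘ xs))

module _ {P : Pred B p} (P? : Decidable P) (f : A → B) where

  filter-map : (xs : List A) → filter P? (map f xs) ≡ map f (filter (P? ∘ f) xs)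
  filter-map []       = refl
  filter-map (x ∷ xs) with does (P? (f x))
  ... | true  = cong (f x ∷_) (filter-map xs)
  ... | false = filter-map xs

module _ {P : Pred A p} {Q : Pred A q} (P? : Decidable P) (Q? : Decidable Q) where

  filter-filter : (xs : List A) → filter Q? (filter P? xs) ≡ filter (P? ∩? Q?) xs
  filter-filter []       = refl
  filter-filter (x ∷ xs) with does (P? x)
  ... | false = filter-filter xs
  ... | true with does (Q? x)
  ...   | true  = cong (x ∷_) (filter-filter xs)
  ...   | false = filter-filter xs

length-filter-map-↭ : {P : Pred A p} (P? : Decidable P) (g : A → A) {xs : List A} → map g xs ↭ xs →
                      length (filter P? xs) ≡ length (filter (P? ∘ g) xs)
length-filter-map-↭ P? g {xs} gxs↭xs = begin
  length (filter P? xs)                 ≡⟨ ↭-length (filter-↭ P? gxs↭xs) ⟨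
  length (filter P? (map g xs))         ≡⟨ cong length (filter-map P? g xs) ⟩
  length (map g (filter (P? ∘ g) xs))   ≡⟨ length-map g (filter (P? ∘ g) xs) ⟩
  length (filter (P? ∘ g) xs)           ∎
  where open ≡-Reasoning

sequences-map : (f : ℤ → ℤ) (m : ℕ) (vs : List ℤ) → sequences m (map f vs) ≡ map (map f) (sequences m vs)
sequences-map f zero    vs = refl
sequences-map f (suc m) vs = begin
  concatMap (λ v → map (v ∷_) (sequences m (map f vs))) (map f vs)
    ≡⟨ concatMap-map _ f vs ⟩
  concatMap (λ v → map (f v ∷_) (sequences m (map f vs))) vs
    ≡⟨ cong (λ S → concatMap (λ v → map (f v ∷_) S) vs) (sequences-map f m vs) ⟩
  concatMap (λ v → map (f v ∷_) (map (map f) (sequences m vs))) vs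
    ≡⟨ concatMap-cong (λ v → map-map-commute (λ _ → refl) (sequences m vs)) vs ⟩
  concatMap (λ v → map (map f) (map (v ∷_) (sequences m vs))) vs
    ≡⟨ map-concatMap (map f) _ vs ⟨
  map (map f) (concatMap (λ v → map (v ∷_) (sequences m vs)) vs) ∎
  where open ≡-Reasoning

sequences-↭ : (m : ℕ) {vs ws : List ℤ} → vs ↭ ws → sequences m vs ↭ sequences m ws
sequences-↭ zero    vs↭ws = ↭-refl
sequences-↭ (suc m) {vs} {ws} vs↭ws = begin
  concatMap (λ v → map (v ∷_) (sequences m vs)) vs  ↭⟨ concatMap-cong-↭ (λ v → map⁺ (v ∷_) (sequences-↭ m vs↭ws)) vs ⟩
  concatMap (λ v → map (v ∷_) (sequences m ws)) vs  ↭⟨ concatMap-↭ _ vs↭ws ⟩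
  concatMap (λ v → map (v ∷_) (sequences m ws)) ws  ∎
  where open PermutationReasoning

adjSwap : ℕ → ℕ → ℕ
adjSwap zero    zero          = 1
adjSwap zero    (suc zero)    = 0
adjSwap zero    (suc (suc j)) = suc (suc j)
adjSwap (suc a) zero          = 0
adjSwap (suc a) (suc j)       = suc (adjSwap a j)

adjSwap-involutive : ∀ a j → adjSwap a (adjSwap a j) ≡ j
adjSwap-involutive zero    zero          = refl
adjSwap-involutive zero    (suc zero)    = refl
adjSwap-involutive zero    (suc (suc j)) = refl
adjSwap-involutive (suc a) zero          = refl
adjSwap-involutive (suc a) (suc j)       = cong suc (adjSwap-involutive a j)

adjSwap-injective : ∀ a → Injective _≡_ _≡_ (adjSwap a)
adjSwap-injective a {i} {j} eq = begin
  i                         ≡⟨ adjSwap-involutive a i ⟨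
  adjSwap a (adjSwap a i)   ≡⟨ cong (adjSwap a) eq ⟩
  adjSwap a (adjSwap a j)   ≡⟨ adjSwap-involutive a j ⟩
  j                         ∎
  where open ≡-Reasoning

adjSwap-< : ∀ a {i j} → i < j → ¬ (i ≡ a × j ≡ suc a) → adjSwap a i < adjSwap a j
adjSwap-< zero    {zero}        {suc zero}    i<j          ne = contradiction (refl , refl) ne
adjSwap-< zero    {zero}        {suc (suc j)} i<j          ne = s<s z<s
adjSwap-< zero    {suc zero}    {suc (suc j)} i<j          ne = z<s
adjSwap-< zero    {suc (suc i)} {suc (suc j)} i<j          ne = i<j
adjSwap-< zero    {suc zero}    {suc zero}    (s<s ())     ne
adjSwap-< zero    {suc (suc i)} {suc zero}    (s<s ())     ne
adjSwap-< (suc a) {zero}        {suc j}       i<j          ne = z<s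
adjSwap-< (suc a) {suc i}       {suc j}       (s<s i<j)    ne =
  s<s (adjSwap-< a i<j λ (i≡a , j≡1+a) → ne (cong suc i≡a , cong suc j≡1+a))

upTo-suc : ∀ n → upTo (suc n) ≡ 0 ∷ map suc (upTo n)
upTo-suc n = cong (0 ∷_) (sym (map-upTo suc n))

map-adjSwap-upTo : ∀ a n → suc a < n → map (adjSwap a) (upTo n) ↭ upTo n
map-adjSwap-upTo zero    (suc zero)    (s<s ())
map-adjSwap-upTo zero    (suc (suc n)) _ = begin
  map (adjSwap 0) (upTo (suc (suc n)))                ≡⟨ cong (map (adjSwap 0)) upTo-2+n ⟩
  1 ∷ 0 ∷ map (adjSwap 0) (map (suc ∘ suc) (upTo n))  ≡⟨ cong (λ xs → 1 ∷ 0 ∷ xs) (map-∘ (upTo n)) ⟨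
  1 ∷ 0 ∷ map (suc ∘ suc) (upTo n)                    ↭⟨ ↭-swap 1 0 ↭-refl ⟩
  0 ∷ 1 ∷ map (suc ∘ suc) (upTo n)                    ≡⟨ upTo-2+n ⟨
  upTo (suc (suc n))                                  ∎
  where
  open PermutationReasoning
  upTo-2+n : upTo (suc (suc n)) ≡ 0 ∷ 1 ∷ map (suc ∘ suc) (upTo n)
  upTo-2+n = sym (cong (λ xs → 0 ∷ 1 ∷ xs) (map-upTo (suc ∘ suc) n))
map-adjSwap-upTo (suc a) (suc n)       (s<s 1+a<n) = begin
  map (adjSwap (suc a)) (upTo (suc n))          ≡⟨ cong (map (adjSwap (suc a))) (upTo-suc n) ⟩
  0 ∷ map (adjSwap (suc a)) (map suc (upTo n))  ≡⟨ cong (0 ∷_) (map-map-commute (λ _ → refl) (upTo n)) ⟩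
  0 ∷ map suc (map (adjSwap a) (upTo n))        ↭⟨ ↭-prep 0 (map⁺ suc (map-adjSwap-upTo a n 1+a<n)) ⟩
  0 ∷ map suc (upTo n)                          ≡⟨ upTo-suc n ⟨
  upTo (suc n)                                  ∎
  where open PermutationReasoning

adjSwapAbs : ℕ → ℤ → ℤ
adjSwapAbs a (+ zero)   = + zero
adjSwapAbs a (+ suc j)  = + suc (adjSwap a j)
adjSwapAbs a -[1+ j ]   = -[1+ adjSwap a j ]

∣adjSwapAbs∣ : ∀ a x → ∣ adjSwapAbs a x ∣ᶻ ≡ adjSwap (suc a) ∣ x ∣ᶻ
∣adjSwapAbs∣ a (+ zero)  = refl
∣adjSwapAbs∣ a (+ suc j) = refl
∣adjSwapAbs∣ a -[1+ j ]  = refl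

isNeg-adjSwapAbs : ∀ a x → isNeg (adjSwapAbs a x) ≡ isNeg x
isNeg-adjSwapAbs a (+ zero)  = refl
isNeg-adjSwapAbs a (+ suc j) = refl
isNeg-adjSwapAbs a -[1+ j ]  = refl

adjSwapAbs-< : ∀ a {x y} → x <ℤ y → x ≢ + suc a → x ≢ -[1+ suc a ] → adjSwapAbs a x <ℤ adjSwapAbs a y
adjSwapAbs-< a { -[1+ i ]} {+ zero}   -<+         _   _   = -<+
adjSwapAbs-< a { -[1+ i ]} {+ suc j}  -<+         _   _   = -<+
adjSwapAbs-< a { -[1+ i ]} { -[1+ j ]} (-<- j<i)   _   x≢ =
  -<- (adjSwap-< a j<i λ (_ , i≡1+a) → x≢ (cong -[1+_] i≡1+a))
adjSwapAbs-< a {+ zero}   {+ suc j}  (+<+ _)     _   _   = +<+ z<s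
adjSwapAbs-< a {+ suc i}  {+ suc j}  (+<+ (s<s i<j)) x≢ _ =
  +<+ (s<s (adjSwap-< a i<j λ (i≡a , _) → x≢ (cong (+_ ∘ suc) i≡a)))

map-adjSwapAbs-values : ∀ a n → suc a < n → map (adjSwapAbs a) (values n) ↭ values n
map-adjSwapAbs-values a n 1+a<n = begin
  map f (map pos (upTo n) ++ map neg (upTo n))
    ≡⟨ map-++ f (map pos (upTo n)) (map neg (upTo n)) ⟩
  map f (map pos (upTo n)) ++ map f (map neg (upTo n))
    ≡⟨ cong₂ _++_ (map-map-commute (λ _ → refl) (upTo n)) (map-map-commute (λ _ → refl) (upTo n)) ⟩
  map pos (map (adjSwap a) (upTo n)) ++ map neg (map (adjSwap a) (upTo n))
    ↭⟨ ++⁺ (map⁺ pos (map-adjSwap-upTo a n 1+a<n)) (map⁺ neg (map-adjSwap-upTo a n 1+a<n)) ⟩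
  map pos (upTo n) ++ map neg (upTo n) ∎
  where
  open PermutationReasoning
  f : ℤ → ℤ
  f = adjSwapAbs a
  pos neg : ℕ → ℤ
  pos j = + suc j
  neg j = -[1+ j ]

allL-map : ∀ {A B : Set} {p : B → Bool} {q : A → Bool} (g : A → B) → (∀ x → p (g x) ≡ q x) →
           ∀ xs → allL p (map g xs) ≡ allL q xs
allL-map g pg≗q []       = refl
allL-map g pg≗q (x ∷ xs) = cong₂ _∧_ (pg≗q x) (allL-map g pg≗q xs)

distinctAbs-map : (g : ℤ → ℤ) (h : ℕ → ℕ) → Injective _≡_ _≡_ h → (∀ x → ∣ g x ∣ᶻ ≡ h ∣ x ∣ᶻ) →
                  ∀ s → distinctAbs (map g s) ≡ distinctAbs s
distinctAbs-map g h h-inj ∣g∣ []      = refl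
distinctAbs-map g h h-inj ∣g∣ (x ∷ s) =
  cong₂ _∧_ (allL-map g (λ y → cong not (does-⇔ (same-abs y) (∣ g x ∣ᶻ ℕ.≟ ∣ g y ∣ᶻ) (∣ x ∣ᶻ ℕ.≟ ∣ y ∣ᶻ))) s)
            (distinctAbs-map g h h-inj ∣g∣ s)
  where
  same-abs : ∀ y → (∣ g x ∣ᶻ ≡ ∣ g y ∣ᶻ) ⇔ (∣ x ∣ᶻ ≡ ∣ y ∣ᶻ)
  same-abs y = mk⇔ (λ e → h-inj (trans (sym (∣g∣ x)) (trans e (∣g∣ y))))
                   (λ e → trans (∣g∣ x) (trans (cong h e) (sym (∣g∣ y))))

infix 5 _∈ᵇ_
_∈ᵇ_ : ∀ {n} → ℕ → Subset n → Bool
zero        ∈ᵇ _       = false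
suc _       ∈ᵇ []      = false
suc zero    ∈ᵇ (x ∷ _) = x
suc (suc j) ∈ᵇ (_ ∷ U) = suc j ∈ᵇ U

lookup-fromℕ<-∈ᵇ : ∀ {n} (U : Subset n) j (j<n : j < n) → lookup U (fromℕ< j<n) ≡ suc j ∈ᵇ U
lookup-fromℕ<-∈ᵇ (x ∷ U) zero    _         = refl
lookup-fromℕ<-∈ᵇ (x ∷ U) (suc j) (s<s j<n) = lookup-fromℕ<-∈ᵇ U j j<n

∈ᵇ-beyond : ∀ {n} (U : Subset n) j → ¬ j < n → suc j ∈ᵇ U ≡ false
∈ᵇ-beyond []      j       _   = refl
∈ᵇ-beyond (x ∷ U) zero    j≮n = contradiction z<s j≮n
∈ᵇ-beyond (x ∷ U) (suc j) j≮n = ∈ᵇ-beyond U j (j≮n ∘ s<s)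

memAbs-+ : ∀ {n} (U : Subset n) m → memAbs U (+ m) ≡ m ∈ᵇ U
memAbs-+     U zero = refl
memAbs-+ {n} U (suc j) with j <? n
... | yes j<n = lookup-fromℕ<-∈ᵇ U j j<n
... | no  j≮n = sym (∈ᵇ-beyond U j j≮n)

memAbs-∣∣ : ∀ {n} (U : Subset n) x → memAbs U x ≡ ∣ x ∣ᶻ ∈ᵇ U
memAbs-∣∣ U (+ m)     = memAbs-+ U m
memAbs-∣∣ U -[1+ j ]  = memAbs-+ U (suc j)

-- Shift a U V: V is U with its element a + 1 replaced by a + 2 ∉ U (position i of a Subset
-- stands for the element i + 1).
data Shift : ∀ {n} → ℕ → Subset n → Subset n → Set where
  here  : ∀ {n} (W : Subset n) → Shift 0 (true ∷ false ∷ W) (false ∷ true ∷ W)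
  there : ∀ {n a} x {U V : Subset n} → Shift a U V → Shift (suc a) (x ∷ U) (x ∷ V)

shift-bound : ∀ {n a} {U V : Subset n} → Shift a U V → suc a < n
shift-bound (here W)    = s<s z<s
shift-bound (there x s) = s<s (shift-bound s)

shift-source : ∀ {n a} {U V : Subset n} → Shift a U V → suc a ∈ᵇ U ≡ true
shift-source (here W)    = refl
shift-source (there x s) = shift-source s

shift-target : ∀ {n a} {U V : Subset n} → Shift a U V → suc (suc a) ∈ᵇ U ≡ false
shift-target (here W)    = refl
shift-target (there x s) = shift-target s

shift-∈ᵇ : ∀ {n a} {U V : Subset n} → Shift a U V → ∀ m → adjSwap (suc a) m ∈ᵇ V ≡ m ∈ᵇ U
shift-∈ᵇ (here W)    zero                = refl
shift-∈ᵇ (here W)    (suc zero)          = refl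
shift-∈ᵇ (here W)    (suc (suc zero))    = refl
shift-∈ᵇ (here W)    (suc (suc (suc j))) = refl
shift-∈ᵇ (there x s) zero                = refl
shift-∈ᵇ (there x s) (suc zero)          = refl
shift-∈ᵇ (there x s) (suc (suc j))       = shift-∈ᵇ s (suc j)

SignedBy : ∀ {n} → Subset n → ℤ → Set
SignedBy U x = isNeg x ≡ memAbs U x

⌊⌋-⇔ : ∀ {A B : Set} → A ⇔ B → (a? : Dec A) (b? : Dec B) → ⌊ a? ⌋ ≡ ⌊ b? ⌋
⌊⌋-⇔ A⇔B a? b? = trans (isYes≗does a?) (trans (does-⇔ A⇔B a? b?) (sym (isYes≗does b?)))

Counted : ∀ {n} → ℕ → Subset n → List ℤ → Set
Counted k W s = distinctAbs s ≡ true × des s ≡ k × signsMatch W s ≡ true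

module _ {n a} {U V : Subset n} (shift : Shift a U V) where

  private
    f : ℤ → ℤ
    f = adjSwapAbs a

  memAbs-shift : ∀ x → memAbs V (f x) ≡ memAbs U x
  memAbs-shift x = begin
    memAbs V (f x)                ≡⟨ memAbs-∣∣ V (f x) ⟩
    ∣ f x ∣ᶻ ∈ᵇ V                 ≡⟨ cong (_∈ᵇ V) (∣adjSwapAbs∣ a x) ⟩
    adjSwap (suc a) ∣ x ∣ᶻ ∈ᵇ V   ≡⟨ shift-∈ᵇ shift ∣ x ∣ᶻ ⟩
    ∣ x ∣ᶻ ∈ᵇ U                   ≡⟨ memAbs-∣∣ U x ⟨
    memAbs U x                    ∎
    where open ≡-Reasoning

  signsMatch-shift : ∀ s → signsMatch V (map f s) ≡ signsMatch U s
  signsMatch-shift = allL-map f λ x →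
    cong₂ (λ neg mem → ⌊ neg Bool.≟ mem ⌋) (isNeg-adjSwapAbs a x) (memAbs-shift x)

  signed-≢-source : ∀ {x} → SignedBy U x → x ≢ + suc a
  signed-≢-source sx refl with () ← trans sx (trans (memAbs-+ U (suc a)) (shift-source shift))

  signed-≢-target : ∀ {x} → SignedBy U x → x ≢ -[1+ suc a ]
  signed-≢-target sx refl with () ← trans sx (trans (memAbs-+ U (suc (suc a))) (shift-target shift))

  shift-<-preserves : ∀ {x y} → SignedBy U x → x <ℤ y → f x <ℤ f y
  shift-<-preserves sx x<y = adjSwapAbs-< a x<y (signed-≢-source sx) (signed-≢-target sx)

  shift-<-⇔ : ∀ {x y} → SignedBy U x → SignedBy U y → (f x <ℤ f y) ⇔ (x <ℤ y)
  shift-<-⇔ {x} {y} sx sy = mk⇔ reflects (shift-<-preserves sx)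
    where
    reflects : f x <ℤ f y → x <ℤ y
    reflects fx<fy with <ℤ-cmp x y
    ... | tri< x<y _ _ = x<y
    ... | tri≈ _ refl _ = contradiction fx<fy (<ℤ-irrefl refl)
    ... | tri> _ _ y<x = contradiction (shift-<-preserves sy y<x) (<ℤ-asym fx<fy)

  desFrom-shift : ∀ {p} s → SignedBy U p → T (signsMatch U s) → desFrom (f p) (map f s) ≡ desFrom p s
  desFrom-shift []      sp _  = refl
  desFrom-shift (x ∷ s) sp ms with mx , ms′ ← Equivalence.to T-∧ ms =
    cong₂ _+_ (cong (λ c → if c then 1 else 0) (⌊⌋-⇔ (shift-<-⇔ sx sp) (f x <ℤ? f _) (x <ℤ? _)))
              (desFrom-shift s sx ms′)
    where
    sx : SignedBy U x
    sx = toWitness mx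

  des-shift : ∀ s → T (signsMatch U s) → des (map f s) ≡ des s
  des-shift s = desFrom-shift s refl

  distinctAbs-shift : ∀ s → distinctAbs (map f s) ≡ distinctAbs s
  distinctAbs-shift = distinctAbs-map f (adjSwap (suc a)) (adjSwap-injective (suc a)) (∣adjSwapAbs∣ a)

  counted-shift : ∀ k → Counted k U ≐ (Counted k V ∘ map f)
  counted-shift k = (λ {s} → to {s}) , (λ {s} → from {s})
    where
    to : ∀ {s} → Counted k U s → Counted k V (map f s)
    to {s} (d , e , m) = trans (distinctAbs-shift s) d
                       , trans (des-shift s (Equivalence.from T-≡ m)) e
                       , trans (signsMatch-shift s) m
    from : ∀ {s} → Counted k V (map f s) → Counted k U s
    from {s} (d , e , m) = trans (sym (distinctAbs-shift s)) d
                         , trans (sym (des-shift s (Equivalence.from T-≡ mU))) e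
                         , mU
      where
      mU : signsMatch U s ≡ true
      mU = trans (sym (signsMatch-shift s)) m

  map-shift-sequences : map (map f) (sequences n (values n)) ↭ sequences n (values n)
  map-shift-sequences = ↭-trans (↭-reflexive (sym (sequences-map f n (values n))))
                                (sequences-↭ n (map-adjSwapAbs-values a n (shift-bound shift)))

  b-shift : ∀ k → b n k U ≡ b n k V
  b-shift k = begin
    length (filter (D U) (filter E S))      ≡⟨ cong length (filter-filter E (D U) S) ⟩
    length (filter (E ∩? D U) S)            ≡⟨ cong length (filter-≐ (E ∩? D U) ((E ∩? D V) ∘ map f)
                                                                     (counted-shift k) S) ⟩
    length (filter ((E ∩? D V) ∘ map f) S)  ≡⟨ length-filter-map-↭ (E ∩? D V) (map f) map-shift-sequences ⟨
    length (filter (E ∩? D V) S)            ≡⟨ cong length (filter-filter E (D V) S) ⟨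
    length (filter (D V) (filter E S))      ∎
    where
    open ≡-Reasoning
    S : List (List ℤ)
    S = sequences n (values n)

    E : (s : List ℤ) → Dec (distinctAbs s ≡ true)
    E s = distinctAbs s Bool.≟ true

    D : (W : Subset n) (s : List ℤ) → Dec (des s ≡ k × signsMatch W s ≡ true)
    D W s = (des s ℕ.≟ k) ×-dec (signsMatch W s Bool.≟ true)

Shifted : ∀ {n} → Rel (Subset n) _
Shifted U V = ∃[ a ] Shift a U V

Connected : ∀ {n} → Rel (Subset n) _
Connected = EqClosure Shifted

b-connected : ∀ {n} k {U V : Subset n} → Connected U V → b n k U ≡ b n k V
b-connected {n} k = gfold isEquivalence (b n k) b-shifted
  where
  b-shifted : ∀ {U V : Subset n} → Shifted U V → b n k U ≡ b n k V
  b-shifted {U} {V} (a , s) = b-shift {n} {a} {U} {V} s k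

∷-connected : ∀ {n} x {U V : Subset n} → Connected U V → Connected (x ∷ U) (x ∷ V)
∷-connected x = gmap (x ∷_) λ (a , s) → suc a , there x s

initial : ∀ n → ℕ → Subset n
initial zero    r       = []
initial (suc n) zero    = false ∷ initial n zero
initial (suc n) (suc r) = true ∷ initial n r

false∷initial-connected : ∀ n r → r ≤ n → Connected (false ∷ initial n r) (initial (suc n) r)
false∷initial-connected n       zero    _         = ε
false∷initial-connected (suc n) (suc r) (s≤s r≤n) =
  bwd (0 , here (initial n r)) ◅ ∷-connected true (false∷initial-connected n r r≤n)

connected-initial : ∀ {n} (U : Subset n) → Connected U (initial n ∣ U ∣)
connected-initial []          = ε
connected-initial (true ∷ U)  = ∷-connected true (connected-initial U)
connected-initial (false ∷ U) =
  ∷-connected false (connected-initial U) ◅◅ false∷initial-connected _ ∣ U ∣ (∣p∣≤n U)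

∣∣-≡⇒connected : ∀ {n} (U V : Subset n) → ∣ U ∣ ≡ ∣ V ∣ → Connected U V
∣∣-≡⇒connected {n} U V ∣U∣≡∣V∣ =
  connected-initial U ◅◅ subst (λ r → Connected (initial n r) V) (sym ∣U∣≡∣V∣)
                                (symmetric _ (connected-initial V))

theorem4p1 : (n k : ℕ) → k ≤ n → (U V : Subset n) → ∣ U ∣ ≡ ∣ V ∣ → b n k U ≡ b n k V
theorem4p1 n k _ U V ∣U∣≡∣V∣ = b-connected k (∣∣-≡⇒connected U V ∣U∣≡∣V∣)
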